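{- Let $M_1,M_2$ be matroids. For all $I,J\in\mathcal{I}(M_1\vee M_2)$ and $y\in J\setminus I$, if $I+y\notin\mathcal{I}(M_1\vee M_2)$, then there exists $x\in I\setminus J$ such that $(I+y)-x\in\mathcal{I}(M_1\vee M_2)$.
   Context: Matroids may be infinite: a matroid on $E$ is a pair $(E,\mathcal{I})$ with $\mathcal{I}\subseteq\mathcal{P}(E)$ satisfying (I1) $\emptyset\in\mathcal{I}$; (I2) closure under subsets; (I3) whenever $I,I'\in\mathcal{I}$ with $I'$ maximal and $I$ not maximal, there is $x\in I'\setminus I$ with $I+x\in\mathcal{I}$; (IM) whenever $I\subseteq X\subseteq E$ and $I\in\mathcal{I}$, the set $\{I'\in\mathcal{I}: I\subseteq I'\subseteq X\}$ has a maximal element. $\mathcal{I}(M_1\vee M_2)=\{I_1\cup I_2: I_1\in\mathcal{I}(M_1), I_2\in\mathcal{I}(M_2)\}$. -}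

module Defs where

open import Level using (0ℓ)
open import Data.Product using (Σ; ∃; ∃-syntax; _×_; _,_)
open import Data.Sum using (_⊎_)
open import Relation.Nullary using (¬_)
open import Relation.Unary using (Pred; _∈_; _∉_; _⊆_; _∪_; ∅)
open import Relation.Binary.PropositionalEquality using (_≡_; _≢_)

Subset : Set → Set₁
Subset E = Pred E 0ℓ

_+ₛ_ : {E : Set} → Subset E → E → Subset E
(I +ₛ y) z = z ∈ I ⊎ z ≡ y

_-ₛ_ : {E : Set} → Subset E → E → Subset E
(I -ₛ x) z = z ∈ I × z ≢ x

_≐_ : {E : Set} → Subset E → Subset E → Set
X ≐ Y = X ⊆ Y × Y ⊆ X

Maximal : {E : Set} → (Subset E → Set) → Subset E → Set₁
Maximal F X = F X × (∀ Y → F Y → X ⊆ Y → Y ⊆ X)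

record Matroid (E : Set) : Set₁ where
  field
    Ind : Subset E → Set
    I1 : Ind ∅
    I2 : ∀ {I J} → Ind J → I ⊆ J → Ind I
    I3 : ∀ {I I′} → Ind I → ¬ Maximal Ind I → Maximal Ind I′ →
         ∃[ x ] (x ∈ I′ × x ∉ I × Ind (I +ₛ x))
    IM : ∀ {I X} → Ind I → I ⊆ X →
         Σ (Subset E) (Maximal (λ I′ → Ind I′ × I ⊆ I′ × I′ ⊆ X))

open Matroid public

Ind∨ : {E : Set} → Matroid E → Matroid E → Subset E → Set₁
Ind∨ M₁ M₂ K = Σ (Subset _) λ I₁ → Σ (Subset _) λ I₂ →
  Ind M₁ I₁ × Ind M₂ I₂ × K ≐ (I₁ ∪ I₂)

-- Write I = X₁ ∪ X₂ with Xₖ ∈ 𝓘(Mₖ) disjoint and draw an edge w → u whenever u ∈ Xₖ, w ∉ Xₖ and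
-- Xₖ - u + w ∈ 𝓘(Mₖ). If some x ∉ J is reachable from y, performing the exchanges along a shortest
-- path from y to x gives (I + y) - x ∈ 𝓘(M₁ ∨ M₂): because the path has no shortcuts, each exchange
-- stays valid after the earlier ones have been made. Otherwise every reachable element lies in
-- J = J₁ ∪ J₂. Extend (reachable ∩ Jₖ) to a maximal independent Pₖ ⊆ (reachable ∩ Jₖ) ∪ Xₖ in Mₖ;
-- an unreachable element of Xₖ outside Pₖ could be exchanged for a reachable one and would then be
-- reachable itself. So I + y ⊆ P₁ ∪ P₂ is independent in M₁ ∨ M₂, a contradiction.

module Submission where

open import Defs
open import Level using (Level)
open import Axiom.ExcludedMiddle using (ExcludedMiddle)
open import Axiom.DoubleNegationElimination using (em⇒dne)
open import Data.Product using (∃-syntax; _×_; Σ; _,_; proj₁; proj₂)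
open import Data.Sum using (_⊎_; inj₁; inj₂; swap)
open import Data.Empty using (⊥; ⊥-elim)
open import Data.Unit using (tt)
open import Function using (_∘_; case_of_)
open import Data.Nat using (ℕ; zero; suc; _+_; _<_; _≤_; z≤n; s≤s; _≤?_)
open import Data.Nat.Properties
  using (m≤n⇒m≤1+n; ≤-trans; ≤-antisym; ≤-pred; <⇒≤; ≰⇒>; 1+n≰n; suc-injective; <-cmp)
open import Data.Nat.Induction using (<-wellFounded)
open import Induction.WellFounded using (Acc; acc)
open import Relation.Binary using (tri<; tri≈; tri>)
open import Relation.Nullary using (¬_; yes; no)
open import Relation.Unary using (_∈_; _∉_; _⊆_; _∪_; _∩_; _∖_; U) renaming (_⊥_ to Disjoint)
open import Relation.Binary.PropositionalEquality
  using (_≡_; _≢_; refl; sym; trans; subst; subst₂)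

module Classical (lem : ∀ {ℓ : Level} → ExcludedMiddle ℓ) {E : Set} where

  dne : ∀ {ℓ} {P : Set ℓ} → ¬ ¬ P → P
  dne = em⇒dne lem

  +ₛ-comm : ∀ {A : Subset E} {a b} → ((A +ₛ a) +ₛ b) ⊆ ((A +ₛ b) +ₛ a)
  +ₛ-comm (inj₁ (inj₁ p)) = inj₁ (inj₁ p)
  +ₛ-comm (inj₁ (inj₂ e)) = inj₂ e
  +ₛ-comm (inj₂ e) = inj₁ (inj₂ e)

  +ₛ⊆ : ∀ {A B : Subset E} {e} → A ⊆ B → e ∈ B → (A +ₛ e) ⊆ B
  +ₛ⊆ A⊆B e∈B (inj₁ p) = A⊆B p
  +ₛ⊆ A⊆B e∈B (inj₂ refl) = e∈B

  -ₛ⊆-ₛ-ₛ+ₛ : ∀ {X : Subset E} {b u} → (X -ₛ u) ⊆ (((X -ₛ b) -ₛ u) +ₛ b)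
  -ₛ⊆-ₛ-ₛ+ₛ {b = b} {x = e} (e∈X , e≢u) with lem {P = e ≡ b}
  ... | yes e≡b = inj₂ e≡b
  ... | no e≢b = inj₁ ((e∈X , e≢b) , e≢u)

  Extension : Matroid E → Subset E → Subset E → Subset E → Set
  Extension M A X P = Ind M P × A ⊆ P × P ⊆ X

  Basis : Matroid E → Subset E → Subset E → Set₁
  Basis M X = Maximal (λ P → Ind M P × P ⊆ X)

  Base : Matroid E → Subset E → Set₁
  Base M = Maximal (Ind M)

  module _ (M : Matroid E) where

    extendable⇒¬base : ∀ {I w} → Ind M (I +ₛ w) → w ∉ I → ¬ Base M I
    extendable⇒¬base {I} {w} indIw w∉I (_ , maximal) =
      w∉I (maximal (I +ₛ w) indIw inj₁ (inj₂ refl))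

    remove⇒¬base : ∀ {K z} → Ind M K → z ∈ K → ¬ Base M (K -ₛ z)
    remove⇒¬base {K} {z} indK z∈K =
      extendable⇒¬base {K -ₛ z} (I2 M indK (+ₛ⊆ {K -ₛ z} proj₁ z∈K)) (λ p → proj₂ p refl)

    extension⇒basis : ∀ {A X P} → Maximal (Extension M A X) P → Basis M X P
    extension⇒basis ((indP , A⊆P , P⊆X) , maximal) =
      (indP , P⊆X) , λ Z (indZ , Z⊆X) P⊆Z → maximal Z (indZ , P⊆Z ∘ A⊆P , Z⊆X) P⊆Z

    extend-to-base : ∀ {I} → Ind M I → ∃[ B ] (Base M B × I ⊆ B)
    extend-to-base indI with IM M {X = U} indI (λ _ → tt)
    ... | B , (indB , I⊆B , _) , maximal =
      B , (indB , λ Z indZ B⊆Z → maximal Z (indZ , B⊆Z ∘ I⊆B , λ _ → tt) B⊆Z) , I⊆B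

    extension-of-base : ∀ {A D K B} → Maximal (Extension M A D) K → Base M B → B ⊆ D → Base M K
    extension-of-base {K = K} ((indK , A⊆K , K⊆D) , maximal) baseB B⊆D = dne λ ¬baseK →
      let x , x∈B , x∉K , indKx = I3 M indK ¬baseK baseB
      in x∉K (maximal (K +ₛ x) (indKx , inj₁ ∘ A⊆K , +ₛ⊆ K⊆D (B⊆D x∈B)) inj₁ (inj₂ refl))

    basis-absorbs : ∀ {X I′ B} → Basis M X I′ → Ind M B → I′ ⊆ B → (B ∩ X) ⊆ I′
    basis-absorbs {I′ = I′} ((_ , I′⊆X) , maximal) indB I′⊆B {b} (b∈B , b∈X) =
      maximal (I′ +ₛ b) (I2 M indB (+ₛ⊆ I′⊆B b∈B) , +ₛ⊆ I′⊆X b∈X) inj₁ (inj₂ refl)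

    outside-basis : ∀ {X I′ B K} → Basis M X I′ → Ind M B → I′ ⊆ B → Base M K → (K ∖ X) ⊆ B →
                    (B ∖ X) ⊆ K
    outside-basis {X} {I′} {B} {K} basis indB I′⊆B baseK K∖X⊆B {w} (w∈B , w∉X) = dne λ w∉K →
      let x , x∈K , x∉N , indNx = I3 M (I2 M indB N⊆B) (extendable⇒¬base indNw (w∉N w∉K)) baseK
          x∈X = dne λ x∉X → x∉N (inj₂ (x∈K , x∉X))
      in x∉N (inj₁ (basis-absorbs basis indNx (inj₁ ∘ inj₁) (inj₂ refl , x∈X)))
      where
        N : Subset E
        N = I′ ∪ (K ∖ X)
        N⊆B : N ⊆ B
        N⊆B (inj₁ p) = I′⊆B p
        N⊆B (inj₂ p) = K∖X⊆B p
        indNw : Ind M (N +ₛ w)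
        indNw = I2 M indB (+ₛ⊆ N⊆B w∈B)
        w∉N : w ∉ K → w ∉ N
        w∉N _ (inj₁ w∈I′) = w∉X (proj₂ (proj₁ basis) w∈I′)
        w∉N w∉K (inj₂ (w∈K , _)) = w∉K w∈K

    -- (I3) for the restriction to X: augment K - z from B, where B ⊇ I′ and K ⊇ I + z are bases
    -- with K ⊆ (I + z) ∪ B; the element gained must lie in X.
    augment-in : ∀ {X I′ I z} → Basis M X I′ → Ind M (I +ₛ z) → I ⊆ X → z ∈ X → z ∉ I →
                 ∃[ x ] (x ∈ I′ × x ∉ I × Ind M (I +ₛ x))
    augment-in {X} {I′} {I} {z} basis indIz I⊆X z∈X z∉I with lem {P = z ∈ I′}
    ... | yes z∈I′ = z , z∈I′ , z∉I , indIz
    ... | no z∉I′ with extend-to-base (proj₁ (proj₁ basis))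
    ... | B , baseB@(indB , _) , I′⊆B with IM M {X = (I +ₛ z) ∪ B} indIz inj₁
    ... | K , extK@((indK , Iz⊆K , K⊆D) , _)
        with I3 M (I2 M indK proj₁) (remove⇒¬base indK (Iz⊆K (inj₂ refl))) baseB
    ... | w , w∈B , w∉K-z , indK-zw =
      w , basis-absorbs basis indB I′⊆B (w∈B , w∈X) , w∉I ,
      I2 M indK-zw λ { (inj₁ p) → inj₁ (I⊆K-z p) ; (inj₂ e) → inj₂ e }
      where
        z∉B : z ∉ B
        z∉B z∈B = z∉I′ (basis-absorbs basis indB I′⊆B (z∈B , z∈X))
        K∖X⊆B : (K ∖ X) ⊆ B
        K∖X⊆B (e∈K , e∉X) with K⊆D e∈K
        ... | inj₁ (inj₁ e∈I) = ⊥-elim (e∉X (I⊆X e∈I))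
        ... | inj₁ (inj₂ refl) = ⊥-elim (e∉X z∈X)
        ... | inj₂ e∈B = e∈B
        I⊆K-z : I ⊆ (K -ₛ z)
        I⊆K-z e∈I = Iz⊆K (inj₁ e∈I) , λ { refl → z∉I e∈I }
        w∈X : w ∈ X
        w∈X = dne λ w∉X → w∉K-z
          ( outside-basis basis indB I′⊆B (extension-of-base extK baseB inj₂) K∖X⊆B (w∈B , w∉X)
          , λ { refl → z∉B w∈B })
        w∉I : w ∉ I
        w∉I w∈I = w∉K-z (I⊆K-z w∈I)

    two-point-augment : ∀ {W a b c} → a ∉ W → a ≢ b → Ind M ((W +ₛ a) +ₛ b) → Ind M (W +ₛ c) →
                        ¬ Ind M ((W +ₛ c) +ₛ a) → Ind M ((W +ₛ c) +ₛ b)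
    -- Otherwise W + c is a basis of W + a + b + c, and augmenting W + b inside it can only add c.
    two-point-augment {W} {a} {b} {c} a∉W a≢b indWab indWc ¬indWca = dne λ ¬indWcb →
      let x , x∈Wc , x∉Wb , indWbx =
            augment-in (basis ¬indWcb) indWba Wb⊆X (inj₁ (inj₁ (inj₂ refl))) a∉Wb
      in excluded x∈Wc x∉Wb indWbx ¬indWcb
      where
        X : Subset E
        X = ((W +ₛ a) +ₛ b) +ₛ c
        Wb⊆X : (W +ₛ b) ⊆ X
        Wb⊆X (inj₁ p) = inj₁ (inj₁ (inj₁ p))
        Wb⊆X (inj₂ e) = inj₁ (inj₂ e)
        indWba : Ind M ((W +ₛ b) +ₛ a)
        indWba = I2 M indWab (+ₛ-comm {W})
        a∉Wb : a ∉ (W +ₛ b)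
        a∉Wb (inj₁ p) = a∉W p
        a∉Wb (inj₂ e) = a≢b e
        basis : ¬ Ind M ((W +ₛ c) +ₛ b) → Basis M X (W +ₛ c)
        basis ¬indWcb = (indWc , λ { (inj₁ p) → inj₁ (inj₁ (inj₁ p)) ; (inj₂ e) → inj₂ e }) ,
                        maximal
          where
            maximal : ∀ Z → Ind M Z × Z ⊆ X → (W +ₛ c) ⊆ Z → Z ⊆ (W +ₛ c)
            maximal Z (indZ , Z⊆X) Wc⊆Z {e} e∈Z with Z⊆X e∈Z
            ... | inj₁ (inj₁ (inj₁ p)) = inj₁ p
            ... | inj₁ (inj₁ (inj₂ refl)) = ⊥-elim (¬indWca (I2 M indZ (+ₛ⊆ Wc⊆Z e∈Z)))
            ... | inj₁ (inj₂ refl) = ⊥-elim (¬indWcb (I2 M indZ (+ₛ⊆ Wc⊆Z e∈Z)))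
            ... | inj₂ e≡c = inj₂ e≡c
        excluded : ∀ {x} → x ∈ (W +ₛ c) → x ∉ (W +ₛ b) → Ind M ((W +ₛ b) +ₛ x) →
                   ¬ Ind M ((W +ₛ c) +ₛ b) → ⊥
        excluded (inj₁ x∈W) x∉Wb _ _ = x∉Wb (inj₁ x∈W)
        excluded (inj₂ refl) _ indWbc ¬indWcb = ¬indWcb (I2 M indWbc (+ₛ-comm {W}))

    unexchangeable∈extension : ∀ {S A P z} → Ind M S → z ∈ S →
      (∀ {a} → a ∈ A → a ∉ S → ¬ Ind M ((S -ₛ z) +ₛ a)) →
      Maximal (Extension M A (A ∪ S)) P → z ∈ P
    unexchangeable∈extension {S} {P = P} {z} indS z∈S unexchangeable extP = dne λ z∉P →
      let x , x∈P , x∉S-z , indS-zx =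
            augment-in (extension⇒basis extP) indS-zz (inj₂ ∘ proj₁) (inj₂ z∈S) (λ p → proj₂ p refl)
      in excluded x∈P x∉S-z indS-zx z∉P
      where
        indS-zz : Ind M ((S -ₛ z) +ₛ z)
        indS-zz = I2 M indS (+ₛ⊆ {S -ₛ z} proj₁ z∈S)
        excluded : ∀ {x} → x ∈ P → x ∉ (S -ₛ z) → Ind M ((S -ₛ z) +ₛ x) → z ∉ P → ⊥
        excluded {x} x∈P x∉S-z indS-zx z∉P with lem {P = x ∈ S}
        ... | yes x∈S = x∉S-z (x∈S , λ { refl → z∉P x∈P })
        ... | no x∉S with proj₂ (proj₂ (proj₁ extP)) x∈P
        ...   | inj₁ x∈A = unexchangeable x∈A x∉S indS-zx
        ...   | inj₂ x∈S = x∉S x∈S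

    exchange-after-shift : ∀ {X b c u w} → b ∈ X → u ≢ b → w ≢ b →
      Ind M ((X -ₛ b) +ₛ c) → ¬ Ind M ((X -ₛ u) +ₛ c) → Ind M ((X -ₛ u) +ₛ w) →
      Ind M ((((X -ₛ b) +ₛ c) -ₛ u) +ₛ w)
    exchange-after-shift {X} {b} {c} {u} {w} b∈X u≢b w≢b indX-b+c ¬indX-u+c indX-u+w =
      I2 M (two-point-augment {W} (λ p → proj₂ (proj₁ p) refl) (λ b≡w → w≢b (sym b≡w))
                                  indWbw indWc ¬indWcb)
           shifted⊆Wcw
      where
        W : Subset E
        W = (X -ₛ b) -ₛ u
        Wbw⊆X-u+w : ((W +ₛ b) +ₛ w) ⊆ ((X -ₛ u) +ₛ w)
        Wbw⊆X-u+w = λ { (inj₁ (inj₁ ((p , _) , p≢u))) → inj₁ (p , p≢u)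
                      ; (inj₁ (inj₂ refl)) → inj₁ (b∈X , λ b≡u → u≢b (sym b≡u))
                      ; (inj₂ e) → inj₂ e }
        indWbw : Ind M ((W +ₛ b) +ₛ w)
        indWbw = I2 M indX-u+w Wbw⊆X-u+w
        indWc : Ind M (W +ₛ c)
        indWc = I2 M indX-b+c λ { (inj₁ p) → inj₁ (proj₁ p) ; (inj₂ e) → inj₂ e }
        X-u+c⊆Wcb : ((X -ₛ u) +ₛ c) ⊆ ((W +ₛ c) +ₛ b)
        X-u+c⊆Wcb = λ { (inj₁ p) → +ₛ-comm {W} (inj₁ (-ₛ⊆-ₛ-ₛ+ₛ {X} p)) ; (inj₂ e) → inj₁ (inj₂ e) }
        ¬indWcb : ¬ Ind M ((W +ₛ c) +ₛ b)
        ¬indWcb ind = ¬indX-u+c (I2 M ind X-u+c⊆Wcb)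
        shifted⊆Wcw : ((((X -ₛ b) +ₛ c) -ₛ u) +ₛ w) ⊆ ((W +ₛ c) +ₛ w)
        shifted⊆Wcw = λ { (inj₁ (inj₁ p , p≢u)) → inj₁ (inj₁ (p , p≢u))
                        ; (inj₁ (inj₂ e , _)) → inj₁ (inj₂ e)
                        ; (inj₂ e) → inj₂ e }

    exchange-before-shift : ∀ {X b c u w} → b ∈ X → c ∉ X → u ∈ X → w ≢ c → Ind M X →
      ¬ Ind M ((X -ₛ u) +ₛ c) → Ind M ((((X -ₛ b) +ₛ c) -ₛ u) +ₛ w) → Ind M ((X -ₛ u) +ₛ w)
    exchange-before-shift {X} {b} {c} {u} {w} b∈X c∉X u∈X w≢c indX ¬indX-u+c indShifted =
      I2 M (two-point-augment {W} (λ p → c∉X (proj₁ (proj₁ p))) (λ c≡w → w≢c (sym c≡w))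
                                  indWcw indWb ¬indWbc)
           (X-u+e⊆Wb+e w)
      where
        W : Subset E
        W = (X -ₛ b) -ₛ u
        X-u+e⊆Wb+e : ∀ e → ((X -ₛ u) +ₛ e) ⊆ ((W +ₛ b) +ₛ e)
        X-u+e⊆Wb+e e = λ { (inj₁ p) → inj₁ (-ₛ⊆-ₛ-ₛ+ₛ {X} p) ; (inj₂ e) → inj₂ e }
        Wcw⊆shifted : ((W +ₛ c) +ₛ w) ⊆ ((((X -ₛ b) +ₛ c) -ₛ u) +ₛ w)
        Wcw⊆shifted = λ { (inj₁ (inj₁ ((p , p≢b) , p≢u))) → inj₁ (inj₁ (p , p≢b) , p≢u)
                        ; (inj₁ (inj₂ refl)) → inj₁ (inj₂ refl , λ { refl → c∉X u∈X })
                        ; (inj₂ e) → inj₂ e }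
        indWcw : Ind M ((W +ₛ c) +ₛ w)
        indWcw = I2 M indShifted Wcw⊆shifted
        indWb : Ind M (W +ₛ b)
        indWb = I2 M indX (+ₛ⊆ {W} (proj₁ ∘ proj₁) b∈X)
        ¬indWbc : ¬ Ind M ((W +ₛ b) +ₛ c)
        ¬indWbc ind = ¬indX-u+c (I2 M ind (X-u+e⊆Wb+e c))

  module _ (M₁ M₂ : Matroid E) where

    Ind∨-∪ : ∀ {X₁ X₂} → Ind M₁ X₁ → Ind M₂ X₂ → Ind∨ M₁ M₂ (X₁ ∪ X₂)
    Ind∨-∪ {X₁} {X₂} ind₁ ind₂ = X₁ , X₂ , ind₁ , ind₂ , (λ p → p) , (λ p → p)

    Ind∨-⊆ : ∀ {K K′} → Ind∨ M₁ M₂ K → K′ ⊆ K → Ind∨ M₁ M₂ K′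
    Ind∨-⊆ {K′ = K′} (X₁ , X₂ , ind₁ , ind₂ , K⊆X , _) K′⊆K =
      (X₁ ∩ K′) , (X₂ ∩ K′) , I2 M₁ ind₁ proj₁ , I2 M₂ ind₂ proj₁ , split , merge
      where
        split : K′ ⊆ ((X₁ ∩ K′) ∪ (X₂ ∩ K′))
        split p with K⊆X (K′⊆K p)
        ... | inj₁ q = inj₁ (q , p)
        ... | inj₂ q = inj₂ (q , p)
        merge : ((X₁ ∩ K′) ∪ (X₂ ∩ K′)) ⊆ K′
        merge (inj₁ q) = proj₂ q
        merge (inj₂ q) = proj₂ q

    Ind∨-comm : ∀ {K} → Ind∨ M₂ M₁ K → Ind∨ M₁ M₂ K
    Ind∨-comm (X₂ , X₁ , ind₂ , ind₁ , K⊆X , X⊆K) =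
      X₁ , X₂ , ind₁ , ind₂ , (λ p → swap (K⊆X p)) , (λ p → X⊆K (swap p))

    Ind∨-disjoint : ∀ {K} → Ind∨ M₁ M₂ K →
      ∃[ X₁ ] ∃[ X₂ ] (Ind M₁ X₁ × Ind M₂ X₂ × Disjoint X₁ X₂ × K ≐ (X₁ ∪ X₂))
    Ind∨-disjoint {K} (X₁ , X₂ , ind₁ , ind₂ , K⊆X , X⊆K) =
      X₁ , (X₂ ∖ X₁) , ind₁ , I2 M₂ ind₂ proj₁ , (λ (p , _ , p∉X₁) → p∉X₁ p) , split , merge
      where
        split : K ⊆ (X₁ ∪ (X₂ ∖ X₁))
        split {e} p with K⊆X p | lem {P = e ∈ X₁}
        ... | inj₁ q | _ = inj₁ q
        ... | inj₂ _ | yes q = inj₁ q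
        ... | inj₂ q | no q′ = inj₂ (q , q′)
        merge : (X₁ ∪ (X₂ ∖ X₁)) ⊆ K
        merge (inj₁ q) = X⊆K (inj₁ q)
        merge (inj₂ q) = X⊆K (inj₂ (proj₁ q))

  Exchange : Matroid E → Subset E → E → E → Set
  Exchange M X w u = u ∈ X × w ∉ X × Ind M ((X -ₛ u) +ₛ w)

  ExchangeEdge : Matroid E → Matroid E → Subset E → Subset E → E → E → Set
  ExchangeEdge M₁ M₂ X₁ X₂ w u = Exchange M₁ X₁ w u ⊎ Exchange M₂ X₂ w u

  record ShortcutFree (G : E → E → Set) (v : ℕ → E) (n : ℕ) : Set where
    field
      step : ∀ i → i < n → G (v i) (v (suc i))
      no-shortcut : ∀ i j → j ≤ n → suc i < j → ¬ G (v i) (v j)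
      injective : ∀ i j → i ≤ n → j ≤ n → v i ≡ v j → i ≡ j

  record ExchangePath (M₁ M₂ : Matroid E) (X₁ X₂ : Subset E) (v : ℕ → E) (n : ℕ) : Set where
    field
      ind₁ : Ind M₁ X₁
      ind₂ : Ind M₂ X₂
      disjoint : Disjoint X₁ X₂
      start∉₁ : v 0 ∉ X₁
      start∉₂ : v 0 ∉ X₂
      shortcut-free : ShortcutFree (ExchangeEdge M₁ M₂ X₁ X₂) v n
    open ShortcutFree shortcut-free public

  ExchangePath-swap : ∀ {M₁ M₂ X₁ X₂ v n} → ExchangePath M₁ M₂ X₁ X₂ v n →
                      ExchangePath M₂ M₁ X₂ X₁ v n
  ExchangePath-swap p = record
    { ind₁ = ind₂ ; ind₂ = ind₁ ; disjoint = λ (q , r) → disjoint (r , q)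
    ; start∉₁ = start∉₂ ; start∉₂ = start∉₁
    ; shortcut-free = record
      { step = λ i i<n → swap (step i i<n)
      ; no-shortcut = λ i j j≤n i+1<j e → no-shortcut i j j≤n i+1<j (swap e)
      ; injective = injective } }
    where open ExchangePath p

  -- The absent shortcuts v₀ → vⱼ (j ≥ 2) supply the hypothesis ¬ Ind M ((X -ₛ u) +ₛ c) of
  -- exchange-after-shift and exchange-before-shift.
  module Shift {M₁ M₂ : Matroid E} {X₁ X₂ : Subset E} {v : ℕ → E} {m : ℕ}
               (p : ExchangePath M₁ M₂ X₁ X₂ v (2 + m))
               (v₁∈X₁ : v 1 ∈ X₁) (indX₁′ : Ind M₁ ((X₁ -ₛ v 1) +ₛ v 0)) where
    open ExchangePath p

    X₁′ : Subset E
    X₁′ = (X₁ -ₛ v 1) +ₛ v 0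

    distinct : ∀ {i j} → i ≤ 2 + m → j ≤ 2 + m → i ≢ j → v i ≢ v j
    distinct i≤ j≤ i≢j eq = i≢j (injective _ _ i≤ j≤ eq)

    no-exchange-from-start : ∀ {j} → 2 ≤ j → j ≤ 2 + m → v j ∈ X₁ → ¬ Ind M₁ ((X₁ -ₛ v j) +ₛ v 0)
    no-exchange-from-start {j} 2≤j j≤ vj∈X₁ ind =
      no-shortcut 0 j j≤ 2≤j (inj₁ (vj∈X₁ , start∉₁ , ind))

    step′ : ∀ i → i < suc m → ExchangeEdge M₁ M₂ X₁′ X₂ (v (suc i)) (v (2 + i))
    step′ i i< with step (suc i) (s≤s i<)
    ... | inj₂ e = inj₂ e
    ... | inj₁ (u∈X₁ , w∉X₁ , ind) =
      inj₁ ( inj₁ (u∈X₁ , u≢v₁)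
           , (λ { (inj₁ (w∈X₁ , _)) → w∉X₁ w∈X₁ ; (inj₂ w≡v₀) → w≢v₀ w≡v₀ })
           , exchange-after-shift M₁ v₁∈X₁ u≢v₁ (λ w≡v₁ → w∉X₁ (subst (_∈ X₁) (sym w≡v₁) v₁∈X₁))
               indX₁′ (no-exchange-from-start (s≤s (s≤s z≤n)) (s≤s i<) u∈X₁) ind )
      where
        u≢v₁ : v (2 + i) ≢ v 1
        u≢v₁ = distinct (s≤s i<) (s≤s z≤n) λ ()
        w≢v₀ : v (suc i) ≢ v 0
        w≢v₀ = distinct (m≤n⇒m≤1+n i<) z≤n λ ()

    2≤1+j : ∀ {i j} → suc i < j → 2 ≤ suc j
    2≤1+j i+1<j = s≤s (≤-trans (s≤s z≤n) i+1<j)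

    no-shortcut′ : ∀ i j → j ≤ suc m → suc i < j →
                   ¬ ExchangeEdge M₁ M₂ X₁′ X₂ (v (suc i)) (v (suc j))
    no-shortcut′ i j j≤ i+1<j (inj₂ e) = no-shortcut (suc i) (suc j) (s≤s j≤) (s≤s i+1<j) (inj₂ e)
    no-shortcut′ i j j≤ i+1<j (inj₁ (inj₂ u≡v₀ , _ , _)) = distinct (s≤s j≤) z≤n (λ ()) u≡v₀
    no-shortcut′ i j j≤ i+1<j (inj₁ (inj₁ (u∈X₁ , _) , w∉X₁′ , ind)) with lem {P = v (suc i) ∈ X₁}
    -- w ∈ X₁ ∖ X₁′ forces w = v₁, and then the edge would be a shortcut from v₀.
    ... | yes w∈X₁ = no-exchange-from-start (2≤1+j i+1<j) (s≤s j≤) u∈X₁ (I2 M₁ ind X₁-u+v₀⊆)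
      where
        w≡v₁ : v (suc i) ≡ v 1
        w≡v₁ = dne λ w≢v₁ → w∉X₁′ (inj₁ (w∈X₁ , w≢v₁))
        X₁-u+v₀⊆ : ((X₁ -ₛ v (suc j)) +ₛ v 0) ⊆ ((X₁′ -ₛ v (suc j)) +ₛ v (suc i))
        X₁-u+v₀⊆ {e} (inj₁ (e∈X₁ , e≢u)) with lem {P = e ≡ v 1}
        ... | yes e≡v₁ = inj₂ (trans e≡v₁ (sym w≡v₁))
        ... | no e≢v₁ = inj₁ (inj₁ (e∈X₁ , e≢v₁) , e≢u)
        X₁-u+v₀⊆ (inj₂ refl) = inj₁ (inj₂ refl , distinct z≤n (s≤s j≤) λ ())
    ... | no w∉X₁ = no-shortcut (suc i) (suc j) (s≤s j≤) (s≤s i+1<j)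
        (inj₁ (u∈X₁ , w∉X₁ , exchange-before-shift M₁ v₁∈X₁ start∉₁ u∈X₁
                               (distinct (m≤n⇒m≤1+n (≤-trans (<⇒≤ i+1<j) j≤)) z≤n λ ())
                               ind₁ (no-exchange-from-start (2≤1+j i+1<j) (s≤s j≤) u∈X₁) ind))

    shifted : ExchangePath M₁ M₂ X₁′ X₂ (v ∘ suc) (suc m)
    shifted = record
      { ind₁ = indX₁′ ; ind₂ = ind₂ ; disjoint = disjoint′
      ; start∉₁ = λ { (inj₁ (_ , v₁≢v₁)) → v₁≢v₁ refl
                    ; (inj₂ v₁≡v₀) → distinct (s≤s z≤n) z≤n (λ ()) v₁≡v₀ }
      ; start∉₂ = λ v₁∈X₂ → disjoint (v₁∈X₁ , v₁∈X₂)
      ; shortcut-free = record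
        { step = step′ ; no-shortcut = no-shortcut′
        ; injective = λ i j i≤ j≤ eq →
            suc-injective (injective (suc i) (suc j) (s≤s i≤) (s≤s j≤) eq) } }
      where
        disjoint′ : Disjoint X₁′ X₂
        disjoint′ (inj₁ (q , _) , r) = disjoint (q , r)
        disjoint′ (inj₂ refl , r) = start∉₂ r

  exchange-along-path : ∀ m {M₁ M₂ X₁ X₂ v} → ExchangePath M₁ M₂ X₁ X₂ v (suc m) →
    Ind∨ M₁ M₂ (((X₁ ∪ X₂) +ₛ v 0) -ₛ v (suc m))
  exchange-along-path₁ : ∀ m {M₁ M₂ X₁ X₂ v} → ExchangePath M₁ M₂ X₁ X₂ v (suc m) →
    v 1 ∈ X₁ → Ind M₁ ((X₁ -ₛ v 1) +ₛ v 0) → Ind∨ M₁ M₂ (((X₁ ∪ X₂) +ₛ v 0) -ₛ v (suc m))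

  exchange-along-path m {M₁} {M₂} {X₁} {X₂} {v} p with ExchangePath.step p 0 (s≤s z≤n)
  ... | inj₁ (v₁∈X₁ , _ , ind) = exchange-along-path₁ m p v₁∈X₁ ind
  ... | inj₂ (v₁∈X₂ , _ , ind) =
    Ind∨-⊆ M₁ M₂ (Ind∨-comm M₁ M₂ (exchange-along-path₁ m (ExchangePath-swap p) v₁∈X₂ ind)) swapped
    where
      swapped : (((X₁ ∪ X₂) +ₛ v 0) -ₛ v (suc m)) ⊆ (((X₂ ∪ X₁) +ₛ v 0) -ₛ v (suc m))
      swapped (inj₁ q , ne) = inj₁ (swap q) , ne
      swapped (inj₂ e , ne) = inj₂ e , ne

  exchange-along-path₁ zero {M₁} {M₂} {X₁} {X₂} {v} p v₁∈X₁ ind =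
    Ind∨-⊆ M₁ M₂ (Ind∨-∪ M₁ M₂ ind (ExchangePath.ind₂ p)) sub
    where
      sub : (((X₁ ∪ X₂) +ₛ v 0) -ₛ v 1) ⊆ (((X₁ -ₛ v 1) +ₛ v 0) ∪ X₂)
      sub (inj₁ (inj₁ q) , ne) = inj₁ (inj₁ (q , ne))
      sub (inj₁ (inj₂ q) , _) = inj₂ q
      sub (inj₂ e , _) = inj₁ (inj₂ e)
  exchange-along-path₁ (suc m) {M₁} {M₂} {X₁} {X₂} {v} p v₁∈X₁ ind =
    Ind∨-⊆ M₁ M₂ (exchange-along-path m (Shift.shifted p v₁∈X₁ ind)) sub
    where
      sub : (((X₁ ∪ X₂) +ₛ v 0) -ₛ v (2 + m)) ⊆ (((((X₁ -ₛ v 1) +ₛ v 0) ∪ X₂) +ₛ v 1) -ₛ v (2 + m))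
      sub {e} (inj₁ (inj₁ q) , ne) with lem {P = e ≡ v 1}
      ... | yes e≡v₁ = inj₂ e≡v₁ , ne
      ... | no e≢v₁ = inj₁ (inj₁ (inj₁ (q , e≢v₁))) , ne
      sub (inj₁ (inj₂ q) , ne) = inj₁ (inj₂ q) , ne
      sub (inj₂ e , ne) = inj₁ (inj₁ (inj₂ e)) , ne

  module Walks (G : E → E → Set) (y : E) where

    data Walk : E → ℕ → Set where
      [] : Walk y 0
      _▷_ : ∀ {a z n} → Walk a n → G a z → Walk z (suc n)

    Minimal : E → ℕ → Set
    Minimal x n = ∀ k → k < n → ¬ Walk x k

    vertex : ∀ {x n} → Walk x n → ℕ → E
    vertex [] i = y
    vertex (_▷_ {z = z} {n = n} r e) i with i ≤? n
    ... | yes _ = vertex r i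
    ... | no _ = z

    vertex-0 : ∀ {x n} (r : Walk x n) → vertex r 0 ≡ y
    vertex-0 [] = refl
    vertex-0 (_▷_ {n = n} r e) with 0 ≤? n
    ... | yes _ = vertex-0 r
    ... | no 0≰n = ⊥-elim (0≰n z≤n)

    vertex-last : ∀ {x n} (r : Walk x n) → vertex r n ≡ x
    vertex-last [] = refl
    vertex-last (_▷_ {n = n} r e) with suc n ≤? n
    ... | yes n+1≤n = ⊥-elim (1+n≰n n+1≤n)
    ... | no _ = refl

    vertex-prefix : ∀ {x n} (r : Walk x n) i → i ≤ n → Walk (vertex r i) i
    vertex-prefix [] .zero z≤n = []
    vertex-prefix (_▷_ {z = z} {n = n} r e) i i≤ with i ≤? n
    ... | yes i≤n = vertex-prefix r i i≤n
    ... | no i≰n = subst (Walk z) (sym (≤-antisym i≤ (≰⇒> i≰n))) (r ▷ e)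

    vertex-step : ∀ {x n} (r : Walk x n) i → i < n → G (vertex r i) (vertex r (suc i))
    vertex-step (_▷_ {z = z} {n = n} r e) i i< with i ≤? n | suc i ≤? n
    ... | no i≰n | _ = ⊥-elim (i≰n (≤-pred i<))
    ... | yes _ | yes i<n = vertex-step r i i<n
    ... | yes i≤n | no i≮n with ≤-antisym i≤n (≤-pred (≰⇒> i≮n))
    ...   | refl rewrite vertex-last r = e

    vertex-minimal : ∀ {x n} (r : Walk x n) → Minimal x n → ∀ i → i ≤ n → Minimal (vertex r i) i
    vertex-minimal [] _ .zero z≤n k ()
    vertex-minimal (_▷_ {z = z} {n = n} r e) minimal i i≤ k k<i walk with i ≤? n
    ... | yes i≤n =
      vertex-minimal r (λ k k<n walk′ → minimal (suc k) (s≤s k<n) (walk′ ▷ e)) i i≤n k k<i walk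
    ... | no i≰n = minimal k (subst (k <_) (≤-antisym i≤ (≰⇒> i≰n)) k<i) walk

    shortest : ∀ {x n} → Walk x n → ∃[ m ] (Walk x m × Minimal x m)
    shortest {x} {n} = go n (<-wellFounded n)
      where
        go : ∀ n → Acc _<_ n → Walk x n → ∃[ m ] (Walk x m × Minimal x m)
        go n (acc shorter) walk with lem {P = ∃[ k ] (k < n × Walk x k)}
        ... | yes (k , k<n , walk′) = go k (shorter k<n) walk′
        ... | no none = n , walk , λ k k<n walk′ → none (k , k<n , walk′)

    shortest⇒shortcut-free : ∀ {x n} (r : Walk x n) → Minimal x n → ShortcutFree G (vertex r) n
    shortest⇒shortcut-free {n = n} r minimal = record
      { step = vertex-step r
      ; no-shortcut = λ i j j≤n i+1<j e →
          vertex-minimal r minimal j j≤n (suc i) i+1<j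
            (vertex-prefix r i (≤-trans (<⇒≤ (<⇒≤ i+1<j)) j≤n) ▷ e)
      ; injective = injective }
      where
        earlier≢ : ∀ {i j} → i < j → j ≤ n → vertex r i ≢ vertex r j
        earlier≢ {i} {j} i<j j≤n eq =
          vertex-minimal r minimal j j≤n i i<j
            (subst (λ t → Walk t i) eq (vertex-prefix r i (≤-trans (<⇒≤ i<j) j≤n)))
        injective : ∀ i j → i ≤ n → j ≤ n → vertex r i ≡ vertex r j → i ≡ j
        injective i j i≤n j≤n eq with <-cmp i j
        ... | tri< i<j _ _ = ⊥-elim (earlier≢ i<j j≤n eq)
        ... | tri≈ _ i≡j _ = i≡j
        ... | tri> _ _ j<i = ⊥-elim (earlier≢ j<i i≤n (sym eq))

    Walk-0 : ∀ {x} → Walk x 0 → x ≡ y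
    Walk-0 [] = refl

  module ExchangeGraph (M₁ M₂ : Matroid E) {X₁ X₂ I : Subset E}
                       (ind₁ : Ind M₁ X₁) (ind₂ : Ind M₂ X₂) (disjoint : Disjoint X₁ X₂)
                       (I≐X₁∪X₂ : I ≐ (X₁ ∪ X₂)) {y : E} (y∉I : y ∉ I) where
    open Walks (ExchangeEdge M₁ M₂ X₁ X₂) y public

    Reachable : Subset E
    Reachable x = Σ ℕ (Walk x)

    y∉X₁ : y ∉ X₁
    y∉X₁ y∈X₁ = y∉I (proj₂ I≐X₁∪X₂ (inj₁ y∈X₁))

    y∉X₂ : y ∉ X₂
    y∉X₂ y∈X₂ = y∉I (proj₂ I≐X₁∪X₂ (inj₂ y∈X₂))

    walk-end-∈ : ∀ {x n} → Walk x (suc n) → x ∈ I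
    walk-end-∈ (_ ▷ inj₁ (x∈X₁ , _)) = proj₂ I≐X₁∪X₂ (inj₁ x∈X₁)
    walk-end-∈ (_ ▷ inj₂ (x∈X₂ , _)) = proj₂ I≐X₁∪X₂ (inj₂ x∈X₂)

    reachable-exchange : ∀ {x} → x ∈ Reachable → x ≢ y → x ∈ I × Ind∨ M₁ M₂ ((I +ₛ y) -ₛ x)
    reachable-exchange {x} (_ , walk) x≢y with shortest walk
    ... | zero , walk′ , _ = ⊥-elim (x≢y (Walk-0 walk′))
    ... | suc m , walk′ , minimal =
      walk-end-∈ walk′ ,
      Ind∨-⊆ M₁ M₂ (subst₂ (λ a b → Ind∨ M₁ M₂ (((X₁ ∪ X₂) +ₛ a) -ₛ b))
                            (vertex-0 walk′) (vertex-last walk′) (exchange-along-path m path))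
             λ { (inj₁ p , p≢x) → inj₁ (proj₁ I≐X₁∪X₂ p) , p≢x ; (inj₂ e , e≢x) → inj₂ e , e≢x }
      where
        path : ExchangePath M₁ M₂ X₁ X₂ (vertex walk′) (suc m)
        path = record
          { ind₁ = ind₁ ; ind₂ = ind₂ ; disjoint = disjoint
          ; start∉₁ = subst (_∉ X₁) (sym (vertex-0 walk′)) y∉X₁
          ; start∉₂ = subst (_∉ X₂) (sym (vertex-0 walk′)) y∉X₂
          ; shortcut-free = shortest⇒shortcut-free walk′ minimal }

    extend-reachable : (M : Matroid E) {X J : Subset E} → Ind M J →
      Σ (Subset E) (Maximal (Extension M (Reachable ∩ J) ((Reachable ∩ J) ∪ X)))
    extend-reachable M indJ = IM M (I2 M indJ proj₂) inj₁

    unreachable∈extension : (M : Matroid E) {X J P : Subset E} {e : E} → Ind M X →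
      (∀ {a} → Exchange M X a e → ExchangeEdge M₁ M₂ X₁ X₂ a e) →
      Maximal (Extension M (Reachable ∩ J) ((Reachable ∩ J) ∪ X)) P →
      e ∈ X → e ∉ Reachable → e ∈ P
    unreachable∈extension M indX edge extP e∈X unreachable =
      unexchangeable∈extension M indX e∈X
        (λ ((n , walk) , _) a∉X ind → unreachable (suc n , walk ▷ edge (e∈X , a∉X , ind))) extP

    reachable⊆⇒independent : ∀ {J₁ J₂} → Ind M₁ J₁ → Ind M₂ J₂ → Reachable ⊆ (J₁ ∪ J₂) →
      Ind∨ M₁ M₂ (I +ₛ y)
    reachable⊆⇒independent indJ₁ indJ₂ reachable⊆J
      with extend-reachable M₁ {X₁} indJ₁ | extend-reachable M₂ {X₂} indJ₂
    ... | P₁ , ext₁@((indP₁ , R∩J₁⊆P₁ , _) , _) | P₂ , ext₂@((indP₂ , R∩J₂⊆P₂ , _) , _) =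
      Ind∨-⊆ M₁ M₂ (Ind∨-∪ M₁ M₂ indP₁ indP₂) covered
      where
        covered : (I +ₛ y) ⊆ (P₁ ∪ P₂)
        covered {e} p with lem {P = e ∈ Reachable}
        covered {e} p | yes e∈R with reachable⊆J e∈R
        ... | inj₁ e∈J₁ = inj₁ (R∩J₁⊆P₁ (e∈R , e∈J₁))
        ... | inj₂ e∈J₂ = inj₂ (R∩J₂⊆P₂ (e∈R , e∈J₂))
        covered (inj₂ refl) | no unreachable = ⊥-elim (unreachable (0 , []))
        covered (inj₁ e∈I) | no unreachable with proj₁ I≐X₁∪X₂ e∈I
        ... | inj₁ e∈X₁ = inj₁ (unreachable∈extension M₁ ind₁ inj₁ ext₁ e∈X₁ unreachable)
        ... | inj₂ e∈X₂ = inj₂ (unreachable∈extension M₂ ind₂ inj₂ ext₂ e∈X₂ unreachable)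

corollary4p7 : (lem : ∀ {ℓ : Level} → ExcludedMiddle ℓ) →
    {E : Set} (M₁ M₂ : Matroid E) (I J : Subset E) (y : E) →
    Ind∨ M₁ M₂ I → Ind∨ M₁ M₂ J → y ∈ J → y ∉ I →
    ¬ Ind∨ M₁ M₂ (I +ₛ y) →
    ∃[ x ] (x ∈ I × x ∉ J × Ind∨ M₁ M₂ ((I +ₛ y) -ₛ x))
corollary4p7 lem {E} M₁ M₂ I J y indI (J₁ , J₂ , indJ₁ , indJ₂ , J⊆J₁∪J₂ , _) y∈J y∉I ¬indI+y =
  let X₁ , X₂ , ind₁ , ind₂ , disjoint , I≐X₁∪X₂ = Ind∨-disjoint M₁ M₂ indI
      open ExchangeGraph M₁ M₂ ind₁ ind₂ disjoint I≐X₁∪X₂ y∉I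
  in case lem {P = ∃[ x ] (x ∉ J × x ∈ Reachable)} of λ
    { (yes (x , x∉J , x∈R)) →
        let x∈I , indI+y-x = reachable-exchange x∈R λ { refl → x∉J y∈J }
        in x , x∈I , x∉J , indI+y-x
    ; (no stuck) → ⊥-elim (¬indI+y (reachable⊆⇒independent indJ₁ indJ₂
        λ {x} x∈R → J⊆J₁∪J₂ (dne λ x∉J → stuck (x , x∉J , x∈R))))
    }
  where open Classical lem {E}
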